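{- Let $r\ge 0$ be an integer and $n$ a fixed positive integer. The sequence $\{\mathfrak{u}_r(n,k)\}_{k=0}^{n}$ is strictly log-concave, i.e. $\mathfrak{u}_r(n,k)^2>\mathfrak{u}_r(n,k-1)\,\mathfrak{u}_r(n,k+1)$ for all $k=1,\dots,n-1$, and hence it is unimodal.
   Context: For a nonnegative integer $r$, the numbers $u_r(n,k)$ ($n,k\ge 0$ integers) are defined by $u_r(n,k)=u_r(n-1,k-1)-((n-1)^2+r)\,u_r(n-1,k)$ for $n\ge k\ge 1$, with $u_r(n,0)=(-1)^n\prod_{i=0}^{n-1}(i^2+r)$, $u_r(0,k)=\delta_{k0}$, and $u_r(n,k)=0$ for $k>n$. The unsigned numbers are $\mathfrak{u}_r(n,k):=(-1)^{n-k}u_r(n,k)=|u_r(n,k)|$. A sequence $c_0,\dots,c_n$ is unimodal if for some index $m$ one has $c_0\le\cdots\le c_m\ge c_{m+1}\ge\cdots\ge c_n$. -}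

module Defs where

open import Data.Nat using (ℕ; zero; suc; _≤_; _<_; _*_)
open import Data.Integer as ℤ using (ℤ; +_; -_)
open import Data.Product using (Σ; _×_)

u : ℕ → ℕ → ℕ → ℤ
u r zero    zero    = + 1
u r zero    (suc k) = + 0
u r (suc n) zero    = ℤ.- (u r n zero ℤ.* (+ (n * n Data.Nat.+ r)))
u r (suc n) (suc k) = u r n k ℤ.- (+ (n * n Data.Nat.+ r)) ℤ.* u r n (suc k)

uu : ℕ → ℕ → ℕ → ℕ
uu r n k = ℤ.∣ u r n k ∣

Unimodal : (ℕ → ℕ) → ℕ → Set
Unimodal c n = Σ ℕ λ m → m ≤ n ×
  ((∀ i → suc i ≤ m → c i ≤ c (suc i)) ×
   (∀ i → m ≤ i → suc i ≤ n → c (suc i) ≤ c i))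

-- Up to sign, u_r(n, ·) are the coefficients of ∏_{i<n} (x + i² + r), a product of linear
-- factors with nonnegative constant terms. Multiplying a PF₂ sequence (log-concave without
-- internal zeros) by x + a keeps it PF₂, and for a ≠ 0 also turns a strict inequality into a
-- strict one; strictness starts at the top end, where 𝔲(n, n) = 1 and 𝔲(n, n + 1) = 0.
-- Finally, by strict log-concavity a sequence that has fallen once keeps falling, so it is
-- unimodal.
module Submission where

open import Defs
open import Data.Nat using (ℕ; zero; suc; _+_; _*_; _∸_; _<_; _≤_; _≤?_; z≤n; s≤s; NonZero)
open import Data.Nat.Properties
open import Data.Nat.Tactic.RingSolver using (solve-∀)
open import Data.Integer as ℤ using (ℤ; +_; -_)
import Data.Integer.Properties as ℤ
import Data.Integer.Tactic.RingSolver as ℤ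
open import Data.Product using (_×_; _,_)
open import Data.Sum using (inj₁; inj₂)
open import Relation.Nullary using (yes; no; contradiction)
open import Relation.Binary.PropositionalEquality

private
  variable
    c : ℕ → ℕ

PF₂ : (ℕ → ℕ) → Set
PF₂ c = ∀ i j → i ≤ j → c i * c (suc j) ≤ c (suc i) * c j

shift : (ℕ → ℕ) → ℕ → ℕ
shift c zero    = 0
shift c (suc k) = c k

-- coefficients of (x + a) · ∑ₖ c k xᵏ
timesXPlus : ℕ → (ℕ → ℕ) → ℕ → ℕ
timesXPlus a c k = shift c k + a * c k

PF₂-shift : PF₂ c → PF₂ (shift c)
PF₂-shift pc zero    j       _         = z≤n
PF₂-shift pc (suc i) (suc j) (s≤s i≤j) = pc i j i≤j

shift-cross : PF₂ c → ∀ i j → i ≤ j → shift c i * c (suc j) ≤ c (suc i) * shift c j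
shift-cross {c} pc zero    j       _         = z≤n
shift-cross {c} pc (suc i) (suc j) (s≤s i≤j) with m≤n⇒m<n∨m≡n i≤j
... | inj₂ refl = ≤-reflexive (*-comm (c i) _)
... | inj₁ i<j  = ≤-trans (pc i (suc j) (m≤n⇒m≤1+n i≤j)) (pc (suc i) j i<j)

shift-cross-sum : PF₂ c → ∀ i j → i ≤ j →
  shift c i * c (suc j) + c i * shift c (suc j) ≤ shift c (suc i) * c j + c (suc i) * shift c j
shift-cross-sum {c} pc i j i≤j = begin
  shift c i * c (suc j) + c i * c j ≤⟨ +-monoˡ-≤ (c i * c j) (shift-cross pc i j i≤j) ⟩
  c (suc i) * shift c j + c i * c j ≡⟨ +-comm (c (suc i) * shift c j) (c i * c j) ⟩
  c i * c j + c (suc i) * shift c j ∎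
  where open ≤-Reasoning

timesXPlus-product : ∀ a c i j → timesXPlus a c i * timesXPlus a c j
  ≡ shift c i * shift c j + a * (shift c i * c j + c i * shift c j) + a * (a * (c i * c j))
timesXPlus-product a c i j = expand a (shift c i) (shift c j) (c i) (c j)
  where
  expand : ∀ a p q x y →
    (p + a * x) * (q + a * y) ≡ p * q + a * (p * y + x * q) + a * (a * (x * y))
  expand = solve-∀

PF₂-timesXPlus : ∀ a → PF₂ c → PF₂ (timesXPlus a c)
PF₂-timesXPlus {c} a pc i j i≤j =
  subst₂ _≤_ (sym (timesXPlus-product a c i (suc j))) (sym (timesXPlus-product a c (suc i) j))
    (+-mono-≤ (+-mono-≤ (PF₂-shift pc i j i≤j) (*-monoʳ-≤ a (shift-cross-sum pc i j i≤j)))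
              (*-monoʳ-≤ a (*-monoʳ-≤ a (pc i j i≤j))))

timesXPlus-strict : ∀ a .{{_ : NonZero a}} → PF₂ c → ∀ i j → i ≤ j →
  c i * c (suc j) < c (suc i) * c j →
  timesXPlus a c i * timesXPlus a c (suc j) < timesXPlus a c (suc i) * timesXPlus a c j
timesXPlus-strict {c} a pc i j i≤j strict =
  subst₂ _<_ (sym (timesXPlus-product a c i (suc j))) (sym (timesXPlus-product a c (suc i) j))
    (+-mono-≤-< (+-mono-≤ (PF₂-shift pc i j i≤j) (*-monoʳ-≤ a (shift-cross-sum pc i j i≤j)))
                (*-monoʳ-< a (*-monoʳ-< a strict)))

𝔲 : ℕ → ℕ → ℕ → ℕ
𝔲 r zero    zero    = 1
𝔲 r zero    (suc k) = 0
𝔲 r (suc n) k       = timesXPlus (n * n + r) (𝔲 r n) k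

PF₂-𝔲 : ∀ r n → PF₂ (𝔲 r n)
PF₂-𝔲 r zero    zero    j _ = z≤n
PF₂-𝔲 r zero    (suc i) j _ = z≤n
PF₂-𝔲 r (suc n)             = PF₂-timesXPlus (n * n + r) (PF₂-𝔲 r n)

𝔲-vanishes : ∀ r n k → n < k → 𝔲 r n k ≡ 0
𝔲-vanishes r zero    (suc k) _         = refl
𝔲-vanishes r (suc n) (suc k) (s≤s n<k) =
  trans (cong₂ (λ x y → x + (n * n + r) * y) (𝔲-vanishes r n k n<k)
                                             (𝔲-vanishes r n (suc k) (m≤n⇒m≤1+n n<k)))
        (*-zeroʳ (n * n + r))

𝔲-diagonal : ∀ r n → 𝔲 r n n ≡ 1
𝔲-diagonal r zero    = refl
𝔲-diagonal r (suc n) =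
  trans (cong₂ (λ x y → x + (n * n + r) * y) (𝔲-diagonal r n) (𝔲-vanishes r n (suc n) ≤-refl))
        (cong suc (*-zeroʳ (n * n + r)))

-- The range k < n includes the triple (n - 1, n, n + 1) beyond the top coefficient,
-- which is the base case of the induction.
𝔲-strictlyLogConcave : ∀ r n k → k < n →
  𝔲 r n k * 𝔲 r n (suc (suc k)) < 𝔲 r n (suc k) * 𝔲 r n (suc k)
𝔲-strictlyLogConcave r (suc n) k (s≤s k≤n) with m≤n⇒m<n∨m≡n k≤n
... | inj₂ refl
  rewrite 𝔲-vanishes r (suc k) (suc (suc k)) ≤-refl | *-zeroʳ (𝔲 r (suc k) k)
        | 𝔲-diagonal r (suc k) = s≤s z≤n
... | inj₁ k<n@(s≤s _) =
  timesXPlus-strict (n * n + r) (PF₂-𝔲 r n) k (suc k) (n≤1+n k) (𝔲-strictlyLogConcave r n k k<n)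

sign : ℕ → ℤ
sign zero    = + 1
sign (suc m) = - sign m

∣sign∣≡1 : ∀ m → ℤ.∣ sign m ∣ ≡ 1
∣sign∣≡1 zero    = refl
∣sign∣≡1 (suc m) = trans (ℤ.∣-i∣≡∣i∣ (sign m)) (∣sign∣≡1 m)

u≡sign*𝔲 : ∀ r n k → u r n k ≡ sign (n + k) ℤ.* + 𝔲 r n k
u≡sign*𝔲 r zero    zero    = refl
u≡sign*𝔲 r zero    (suc k) = sym (ℤ.*-zeroʳ (sign (suc k)))
u≡sign*𝔲 r (suc n) zero    = begin
  - (u r n 0 ℤ.* + a)                          ≡⟨ cong (λ z → - (z ℤ.* + a)) (u≡sign*𝔲 r n 0) ⟩
  - (sign (n + 0) ℤ.* + 𝔲 r n 0 ℤ.* + a)       ≡⟨ reorder (sign (n + 0)) (+ 𝔲 r n 0) (+ a) ⟩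
  - sign (n + 0) ℤ.* (+ a ℤ.* + 𝔲 r n 0)       ≡⟨ cong (- sign (n + 0) ℤ.*_) (sym (ℤ.pos-* a _)) ⟩
  - sign (n + 0) ℤ.* + (a * 𝔲 r n 0)           ∎
  where
  open ≡-Reasoning
  a = n * n + r
  reorder : ∀ s x y → - (s ℤ.* x ℤ.* y) ≡ - s ℤ.* (y ℤ.* x)
  reorder = ℤ.solve-∀
u≡sign*𝔲 r (suc n) (suc k) = begin
  u r n k ℤ.- + a ℤ.* u r n (suc k)
    ≡⟨ cong₂ (λ x y → x ℤ.- + a ℤ.* y) (u≡sign*𝔲 r n k) (u≡sign*𝔲 r n (suc k)) ⟩
  s ℤ.* + 𝔲 r n k ℤ.- + a ℤ.* (sign (n + suc k) ℤ.* + 𝔲 r n (suc k))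
    ≡⟨ cong (λ m → s ℤ.* + 𝔲 r n k ℤ.- + a ℤ.* (sign m ℤ.* + 𝔲 r n (suc k))) (+-suc n k) ⟩
  s ℤ.* + 𝔲 r n k ℤ.- + a ℤ.* (- s ℤ.* + 𝔲 r n (suc k))
    ≡⟨ collect s (+ 𝔲 r n k) (+ a) (+ 𝔲 r n (suc k)) ⟩
  - - s ℤ.* (+ 𝔲 r n k ℤ.+ + a ℤ.* + 𝔲 r n (suc k))
    ≡⟨ cong₂ ℤ._*_ (cong (λ m → - sign m) (sym (+-suc n k)))
                   (cong (ℤ._+_ (+ 𝔲 r n k)) (sym (ℤ.pos-* a (𝔲 r n (suc k))))) ⟩
  - sign (n + suc k) ℤ.* (+ 𝔲 r n k ℤ.+ + (a * 𝔲 r n (suc k)))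
    ≡⟨ cong (- sign (n + suc k) ℤ.*_) (sym (ℤ.pos-+ (𝔲 r n k) _)) ⟩
  - sign (n + suc k) ℤ.* + (𝔲 r n k + a * 𝔲 r n (suc k)) ∎
  where
  open ≡-Reasoning
  a = n * n + r
  s = sign (n + k)
  collect : ∀ s x a y → s ℤ.* x ℤ.- a ℤ.* (- s ℤ.* y) ≡ - - s ℤ.* (x ℤ.+ a ℤ.* y)
  collect = ℤ.solve-∀

uu≡𝔲 : ∀ r n k → uu r n k ≡ 𝔲 r n k
uu≡𝔲 r n k = begin
  ℤ.∣ u r n k ∣                            ≡⟨ cong ℤ.∣_∣ (u≡sign*𝔲 r n k) ⟩
  ℤ.∣ sign (n + k) ℤ.* + 𝔲 r n k ∣        ≡⟨ ℤ.abs-* (sign (n + k)) (+ 𝔲 r n k) ⟩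
  ℤ.∣ sign (n + k) ∣ * 𝔲 r n k            ≡⟨ cong (_* 𝔲 r n k) (∣sign∣≡1 (n + k)) ⟩
  1 * 𝔲 r n k                              ≡⟨ *-identityˡ (𝔲 r n k) ⟩
  𝔲 r n k                                  ∎
  where open ≡-Reasoning

DescentClosed : (ℕ → ℕ) → ℕ → Set
DescentClosed c n = ∀ i → suc (suc i) ≤ n → c (suc i) ≤ c i → c (suc (suc i)) ≤ c (suc i)

strictlyLogConcave⇒descentClosed : ∀ n →
  (∀ k → suc (suc k) ≤ n → c k * c (suc (suc k)) < c (suc k) * c (suc k)) →
  DescentClosed c n
strictlyLogConcave⇒descentClosed {c} n slc i i+2≤n fall = <⇒≤ (*-cancelˡ-< (c i) _ _ (begin-strict
  c i * c (suc (suc i))       <⟨ slc i i+2≤n ⟩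
  c (suc i) * c (suc i)       ≤⟨ *-monoˡ-≤ (c (suc i)) fall ⟩
  c i * c (suc i)             ∎))
  where open ≤-Reasoning

Unimodal-extendDown : ∀ n → Unimodal c n → c (suc n) ≤ c n → Unimodal c (suc n)
Unimodal-extendDown {c} n (m , m≤n , rise , fall) last = m , m≤n⇒m≤1+n m≤n , rise , fall′
  where
  fall′ : ∀ i → m ≤ i → suc i ≤ suc n → c (suc i) ≤ c i
  fall′ i m≤i (s≤s i≤n) with m≤n⇒m<n∨m≡n i≤n
  ... | inj₁ i<n  = fall i m≤i i<n
  ... | inj₂ refl = last

Unimodal-extendUp : ∀ n → (∀ i → suc i ≤ n → c i ≤ c (suc i)) → c n ≤ c (suc n) →
  Unimodal c (suc n)
Unimodal-extendUp {c} n rise last =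
  suc n , ≤-refl , rise′ , λ i n<i i<n → contradiction (≤-trans i<n n<i) (<-irrefl refl)
  where
  rise′ : ∀ i → suc i ≤ suc n → c i ≤ c (suc i)
  rise′ i (s≤s i≤n) with m≤n⇒m<n∨m≡n i≤n
  ... | inj₁ i<n  = rise i i<n
  ... | inj₂ refl = last

Unimodal-peakAtEnd : ∀ n → DescentClosed c (suc n) → Unimodal c n → c n < c (suc n) →
  ∀ i → suc i ≤ n → c i ≤ c (suc i)
Unimodal-peakAtEnd n _ (m , m≤n , rise , _) _ i i<n with m≤n⇒m<n∨m≡n m≤n
... | inj₂ refl = rise i i<n
Unimodal-peakAtEnd (suc n) closed (_ , _ , _ , fall) rising _ _ | inj₁ (s≤s m≤n) =
  contradiction (closed n ≤-refl (fall n m≤n ≤-refl)) (<⇒≱ rising)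

DescentClosed-pred : ∀ n → DescentClosed c (suc n) → DescentClosed c n
DescentClosed-pred n closed i i+2≤n = closed i (m≤n⇒m≤1+n i+2≤n)

descentClosed⇒unimodal : ∀ n → DescentClosed c n → Unimodal c n
descentClosed⇒unimodal zero    _ = zero , z≤n , (λ _ ()) , (λ _ _ ())
descentClosed⇒unimodal {c} (suc n) closed
  with c (suc n) ≤? c n | descentClosed⇒unimodal n (DescentClosed-pred n closed)
... | yes down | unimodal = Unimodal-extendDown n unimodal down
... | no up    | unimodal =
  Unimodal-extendUp n (Unimodal-peakAtEnd n closed unimodal (≰⇒> up)) (<⇒≤ (≰⇒> up))

mainTheorem4 : (r n : ℕ) → 1 ≤ n →
    ((k : ℕ) → 1 ≤ k → suc k ≤ n →
      uu r n (k Data.Nat.∸ 1) * uu r n (suc k) < uu r n k * uu r n k)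
    × Unimodal (uu r n) n
mainTheorem4 r n _ = logConcave , descentClosed⇒unimodal n
  (strictlyLogConcave⇒descentClosed n (λ k k+2≤n → logConcave (suc k) (s≤s z≤n) k+2≤n))
  where
  logConcave : (k : ℕ) → 1 ≤ k → suc k ≤ n →
    uu r n (k ∸ 1) * uu r n (suc k) < uu r n k * uu r n k
  logConcave (suc k) _ k+2≤n rewrite uu≡𝔲 r n k | uu≡𝔲 r n (suc k) | uu≡𝔲 r n (suc (suc k)) =
    𝔲-strictlyLogConcave r n k (<-trans (n<1+n k) k+2≤n)
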